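{- Let $k$ be a positive integer, let $r=\pi(k)$, let $q_1<\cdots<q_r$ be the primes in $\{1,\ldots,k\}$, and let \[ \mathcal{C}_k=\Bigl\{(i_1,\ldots,i_r)\in \mathbb{N}_0^r \;\Bigm|\; \prod_{j=1}^r q_j^{i_j}\leq k\Bigr\}. \] If there exists a logarithm of length $k$, then there exists a $\mathbb{Z}$-tiling of $\mathbb{Z}^r$ by $\mathcal{C}_k$.
   Context: $\mathbb{N}_0$ is the set of non-negative integers and $\pi(k)$ the number of primes $\le k$. A logarithmic function of length $k$ is a map $f:\{1,\ldots,k\}\to\mathbb{Z}_k$ with $f(ab)=f(a)+f(b)$ whenever $a,b\in\{1,\ldots,k\}$ and $ab\le k$; a logarithm of length $k$ is a bijective logarithmic function. For a finite set $\mathcal{C}\subseteq\mathbb{Z}^r$, a $\mathbb{Z}$-tiling of $\mathbb{Z}^r$ by $\mathcal{C}$ is a set $L\subseteq\mathbb{Z}^r$ such that the sets $x+\mathcal{C}$, $x\in L$, are pairwise disjoint with union $\mathbb{Z}^r$. -}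

module Defs where

open import Data.Nat using (ℕ; suc; _+_; _*_; _^_; _≤_; NonZero)
open import Data.Nat.DivMod using (_%_)
open import Data.Nat.Primality using (prime?)
open import Data.Fin using (Fin; toℕ; zero; suc)
open import Data.List using (List; filter; upTo; length; lookup)
open import Data.Integer using (ℤ; +_) renaming (_+_ to _+ℤ_)
open import Data.Product using (Σ; _×_; ∃)
open import Function.Definitions using (Bijective)
open import Relation.Binary.PropositionalEquality using (_≡_)

-- {1,…,k} is represented by Fin k, the index a standing for toℕ a + 1.
-- ℤ_k is represented by Fin k (residues 0,…,k-1) with addition mod k.
-- A logarithmic function of length k (k positive, written k = suc n):
IsLogarithmic : (n : ℕ) → (Fin (suc n) → Fin (suc n)) → Set
IsLogarithmic n f =
  ∀ (a b c : Fin (suc n)) →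
    (toℕ a + 1) * (toℕ b + 1) ≡ toℕ c + 1 →
    toℕ (f c) ≡ (toℕ (f a) + toℕ (f b)) % suc n

IsLogarithm : (n : ℕ) → (Fin (suc n) → Fin (suc n)) → Set
IsLogarithm n f = IsLogarithmic n f × Bijective _≡_ _≡_ f

primesUpTo : ℕ → List ℕ
primesUpTo k = filter prime? (upTo (suc k))

π : ℕ → ℕ
π k = length (primesUpTo k)

-- q_j (j : Fin (π k), 0-indexed)
q : (k : ℕ) → Fin (π k) → ℕ
q k = lookup (primesUpTo k)

prodFin : (r : ℕ) → (Fin r → ℕ) → ℕ
prodFin ℕ.zero g = 1
prodFin (suc r) g = g zero * prodFin r (λ j → g (suc j))

InC : (k : ℕ) → (Fin (π k) → ℕ) → Set
InC k i = prodFin (π k) (λ j → q k j ^ i j) ≤ k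

_≐_ : {r : ℕ} → (Fin r → ℤ) → (Fin r → ℤ) → Set
x ≐ y = ∀ j → x j ≡ y j

_⊕_ : {r : ℕ} → (Fin r → ℤ) → (Fin r → ℕ) → (Fin r → ℤ)
(x ⊕ c) j = x j +ℤ + (c j)

IsTiling : (k : ℕ) → ((Fin (π k) → ℤ) → Set) → Set
IsTiling k L =
  (∀ (z : Fin (π k) → ℤ) →
     Σ (Fin (π k) → ℤ) λ x → Σ (Fin (π k) → ℕ) λ c →
       L x × InC k c × (z ≐ (x ⊕ c)))
  ×
  (∀ (x x' : Fin (π k) → ℤ) (c c' : Fin (π k) → ℕ) →
     L x → L x' → InC k c → InC k c' →
     (x ⊕ c) ≐ (x' ⊕ c') → x ≐ x')

-- Let G be a logarithm of length k, r = π(k), and give the j-th prime q_j the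
-- weight w_j = G(q_j) ∈ {0,…,k-1}.  For an exponent vector c the logarithmic
-- law gives  G(∏ q_j^{c_j}) ≡ ⟨c,w⟩ (mod k)  whenever ∏ q_j^{c_j} ≤ k.  Since
-- c ↦ ∏ q_j^{c_j} is a bijection 𝒞_k → {1,…,k} (unique factorisation) and G
-- is a bijection {1,…,k} → ℤ_k, the map c ↦ ⟨c,w⟩ mod k is a bijection
-- 𝒞_k → ℤ_k: 𝒞_k is a complete residue system for the weight w.
module Submission where

open import Defs
open import Data.Nat using (ℕ; zero; suc; _+_; _*_; _^_; _≤_; _<_; z≤n; s≤s; NonZero; _<?_)
open import Data.Nat.Properties
open import Algebra.Properties.CommutativeSemigroup *-commutativeSemigroup using (x∙yz≈y∙xz)
open import Data.Nat.DivMod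
  using (_%_; _/_; m≡m%n+[m/n]*n; %-distribˡ-+; m%n%n≡m%n; [m+kn]%n≡m%n; m<n⇒m%n≡m)
open import Data.Nat.Divisibility using (_∣_; divides; ∣1⇒≡1)
open import Data.Nat.Primality
open import Data.Nat.Primality.Factorisation using (factorise)
open import Data.Integer using (ℤ; +_; -[1+_]; -_)
  renaming (_+_ to _+ℤ_; _*_ to _*ℤ_; _-_ to _-ℤ_)
open import Data.Integer.Properties using (pos-+; pos-*; +-injective)
open import Data.Integer.DivMod using (_%ℕ_; _/ℕ_; a≡a%ℕn+[a/ℕn]*n; n%ℕd<d)
open import Data.Integer.Tactic.RingSolver using (solve-∀)
open import Data.Fin using (Fin; zero; suc; toℕ; fromℕ<)
open import Data.Fin.Properties using (toℕ-fromℕ<; fromℕ<-toℕ; toℕ<n; toℕ-injective)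
open import Data.Vec.Functional using (head; tail; updateAt)
open import Data.List using (List; []; _∷_; upTo; length; lookup)
open import Data.Nat.ListAction using (product)
open import Data.List.Relation.Unary.All using (All; []; _∷_)
open import Data.List.Relation.Unary.All.Properties using (all-filter)
open import Data.List.Relation.Unary.AllPairs using ([]; _∷_)
open import Data.List.Relation.Unary.Any using (index)
open import Data.List.Relation.Unary.Any.Properties using (lookup-index)
open import Data.List.Relation.Unary.Unique.Propositional using (Unique)
import Data.List.Relation.Unary.Unique.Propositional.Properties as Unique
open import Data.List.Membership.Propositional.Properties using (∈-filter⁺; ∈-upTo⁺)
open import Data.Product using (Σ; ∃; _×_; _,_; proj₁; proj₂)
open import Data.Sum using (inj₁; inj₂)
open import Data.Empty using (⊥-elim)
open import Relation.Nullary using (¬_; yes; no)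
open import Relation.Binary.PropositionalEquality

-- Part 1.  Tilings by complete residue systems (any dimension r, modulus k)

_·ℕ_ : {r : ℕ} → (Fin r → ℕ) → (Fin r → ℕ) → ℕ
_·ℕ_ {zero}  c w = 0
_·ℕ_ {suc r} c w = head c * head w + tail c ·ℕ tail w

_·ℤ_ : {r : ℕ} → (Fin r → ℤ) → (Fin r → ℕ) → ℤ
_·ℤ_ {zero}  x w = + 0
_·ℤ_ {suc r} x w = head x *ℤ + head w +ℤ tail x ·ℤ tail w

·ℤ-cong : {r : ℕ} (w : Fin r → ℕ) {x y : Fin r → ℤ} → x ≐ y → x ·ℤ w ≡ y ·ℤ w
·ℤ-cong {zero}  w x≐y = refl
·ℤ-cong {suc r} w x≐y =
  cong₂ (λ a b → a *ℤ + head w +ℤ b) (x≐y zero) (·ℤ-cong (tail w) (λ j → x≐y (suc j)))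

pos-linear : ∀ b w k → + (b + w * k) ≡ + b +ℤ + w *ℤ + k
pos-linear b w k = trans (pos-+ b (w * k)) (cong (+ b +ℤ_) (pos-* w k))

·ℤ-⊕ : {r : ℕ} (w : Fin r → ℕ) (x : Fin r → ℤ) (c : Fin r → ℕ) →
       (x ⊕ c) ·ℤ w ≡ x ·ℤ w +ℤ + (c ·ℕ w)
·ℤ-⊕ {zero}  w x c = refl
·ℤ-⊕ {suc r} w x c = begin
    (head x +ℤ + head c) *ℤ + head w +ℤ (tail x ⊕ tail c) ·ℤ tail w
  ≡⟨ cong ((head x +ℤ + head c) *ℤ + head w +ℤ_) (·ℤ-⊕ (tail w) (tail x) (tail c)) ⟩
    (head x +ℤ + head c) *ℤ + head w +ℤ (tail x ·ℤ tail w +ℤ + (tail c ·ℕ tail w))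
  ≡⟨ regroup (head x) (+ head c) (+ head w) (tail x ·ℤ tail w) (+ (tail c ·ℕ tail w)) ⟩
    (head x *ℤ + head w +ℤ tail x ·ℤ tail w) +ℤ (+ head c *ℤ + head w +ℤ + (tail c ·ℕ tail w))
  ≡⟨ cong ((head x *ℤ + head w +ℤ tail x ·ℤ tail w) +ℤ_)
          (sym (trans (pos-+ (head c * head w) _) (cong (_+ℤ + (tail c ·ℕ tail w)) (pos-* (head c) (head w))))) ⟩
    (head x *ℤ + head w +ℤ tail x ·ℤ tail w) +ℤ + (head c * head w + tail c ·ℕ tail w)
  ∎
  where
  open ≡-Reasoning
  regroup : ∀ a b u A B → (a +ℤ b) *ℤ u +ℤ (A +ℤ B) ≡ (a *ℤ u +ℤ A) +ℤ (b *ℤ u +ℤ B)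
  regroup = solve-∀

module _ (k : ℕ) .{{_ : NonZero k}} where

  %-congruent : ∀ a b (d : ℤ) → + a ≡ + b +ℤ d *ℤ + k → a % k ≡ b % k
  %-congruent a b (+ w) e =
    trans (cong (_% k) (+-injective (trans e (sym (pos-linear b w k))))) ([m+kn]%n≡m%n b w k)
  %-congruent a b -[1+ w ] e = sym (%-congruent b a (+ suc w) (swap (+ a) (+ b) -[1+ w ] (+ k) e))
    where
    swap : ∀ a b d K → a ≡ b +ℤ d *ℤ K → b ≡ a +ℤ (- d) *ℤ K
    swap a b d K e = trans (cancel b d K) (cong (_+ℤ (- d) *ℤ K) (sym e))
      where
      cancel : ∀ b d K → b ≡ (b +ℤ d *ℤ K) +ℤ (- d) *ℤ K
      cancel = solve-∀

  residue-decomposition : ∀ m → + m ≡ + (m % k) +ℤ + (m / k) *ℤ + k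
  residue-decomposition m = trans (cong +_ (m≡m%n+[m/n]*n m k)) (pos-linear (m % k) (m / k) k)

record CompleteResidueSystem {r : ℕ} (k : ℕ) .{{_ : NonZero k}}
         (w : Fin r → ℕ) (C : (Fin r → ℕ) → Set) : Set where
  field
    hit      : ∀ t → t < k → Σ (Fin r → ℕ) λ c → C c × (c ·ℕ w) % k ≡ t
    separate : ∀ c c' → C c → C c' → (c ·ℕ w) % k ≡ (c' ·ℕ w) % k → ∀ j → c j ≡ c' j

Kernel : {r : ℕ} → ℕ → (Fin r → ℕ) → (Fin r → ℤ) → Set
Kernel k w x = Σ ℤ λ u → x ·ℤ w ≡ u *ℤ + k

-- L is a ℤ-tiling of ℤ^r by C (the shape of IsTiling for arbitrary r and C).
IsTilingBy : (r : ℕ) → ((Fin r → ℕ) → Set) → ((Fin r → ℤ) → Set) → Set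
IsTilingBy r C L =
  (∀ (z : Fin r → ℤ) →
     Σ (Fin r → ℤ) λ x → Σ (Fin r → ℕ) λ c → L x × C c × (z ≐ (x ⊕ c)))
  ×
  (∀ (x x' : Fin r → ℤ) (c c' : Fin r → ℕ) →
     L x → L x' → C c → C c' → (x ⊕ c) ≐ (x' ⊕ c') → x ≐ x')

difference-of-residues : ∀ X S Z t A B K →
  X +ℤ S ≡ Z → Z ≡ t +ℤ A *ℤ K → S ≡ t +ℤ B *ℤ K → X ≡ (A -ℤ B) *ℤ K
difference-of-residues X S Z t A B K X+S≡Z Z≡t+AK S≡t+BK = begin
  X                               ≡⟨ add-subtract X S ⟩
  (X +ℤ S) -ℤ S                   ≡⟨ cong₂ _-ℤ_ (trans X+S≡Z Z≡t+AK) S≡t+BK ⟩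
  (t +ℤ A *ℤ K) -ℤ (t +ℤ B *ℤ K)  ≡⟨ cancel-residue t A B K ⟩
  (A -ℤ B) *ℤ K                   ∎
  where
  open ≡-Reasoning
  add-subtract : ∀ X S → X ≡ (X +ℤ S) -ℤ S
  add-subtract = solve-∀
  cancel-residue : ∀ t A B K → (t +ℤ A *ℤ K) -ℤ (t +ℤ B *ℤ K) ≡ (A -ℤ B) *ℤ K
  cancel-residue = solve-∀

shift-multiples : ∀ a b u u' K → u *ℤ K +ℤ a ≡ u' *ℤ K +ℤ b → a ≡ b +ℤ (u' -ℤ u) *ℤ K
shift-multiples a b u u' K e = trans (isolate a u K) (trans (cong (_-ℤ u *ℤ K) e) (collect b u u' K))
  where
  isolate : ∀ a u K → a ≡ (u *ℤ K +ℤ a) -ℤ u *ℤ K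
  isolate = solve-∀
  collect : ∀ b u u' K → (u' *ℤ K +ℤ b) -ℤ u *ℤ K ≡ b +ℤ (u' -ℤ u) *ℤ K
  collect = solve-∀

module _ {r : ℕ} (k : ℕ) .{{_ : NonZero k}} (w : Fin r → ℕ) (C : (Fin r → ℕ) → Set)
         (crs : CompleteResidueSystem k w C) where
  open CompleteResidueSystem crs

  -- Covering: choose c ∈ C with ⟨c,w⟩ ≡ ⟨z,w⟩ (mod k); then x = z - c lies
  -- in the kernel, as ⟨x,w⟩ = ⟨z,w⟩ - ⟨c,w⟩ and both terms have residue t.
  kernel-covers : ∀ (z : Fin r → ℤ) →
    Σ (Fin r → ℤ) λ x → Σ (Fin r → ℕ) λ c → Kernel k w x × C c × (z ≐ (x ⊕ c))
  kernel-covers z = x , c , (z ·ℤ w /ℕ k -ℤ + (c ·ℕ w / k) , x∈kernel) , c∈C , z≐x⊕c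
    where
    t = z ·ℤ w %ℕ k
    hit-t = hit t (n%ℕd<d (z ·ℤ w) k)
    c = proj₁ hit-t
    c∈C = proj₁ (proj₂ hit-t)
    x : Fin r → ℤ
    x j = z j -ℤ + c j
    z≐x⊕c : z ≐ (x ⊕ c)
    z≐x⊕c j = subtract-add (z j) (+ c j)
      where
      subtract-add : ∀ a b → a ≡ (a -ℤ b) +ℤ b
      subtract-add = solve-∀
    x∈kernel : x ·ℤ w ≡ (z ·ℤ w /ℕ k -ℤ + (c ·ℕ w / k)) *ℤ + k
    x∈kernel = difference-of-residues (x ·ℤ w) (+ (c ·ℕ w)) (z ·ℤ w) (+ t)
      (z ·ℤ w /ℕ k) (+ (c ·ℕ w / k)) (+ k)
      (trans (sym (·ℤ-⊕ w x c)) (sym (·ℤ-cong w z≐x⊕c)))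
      (a≡a%ℕn+[a/ℕn]*n (z ·ℤ w) k)
      (trans (residue-decomposition k (c ·ℕ w)) (cong (λ s → + s +ℤ + (c ·ℕ w / k) *ℤ + k) (proj₂ (proj₂ hit-t))))

  -- Disjointness: x + c = x' + c' with x, x' in the kernel forces
  -- ⟨c,w⟩ ≡ ⟨c',w⟩ (mod k), hence c = c' and x = x'.
  kernel-translates-disjoint : ∀ (x x' : Fin r → ℤ) (c c' : Fin r → ℕ) →
    Kernel k w x → Kernel k w x' → C c → C c' → (x ⊕ c) ≐ (x' ⊕ c') → x ≐ x'
  kernel-translates-disjoint x x' c c' (u , ⟨x,w⟩≡uk) (u' , ⟨x',w⟩≡u'k) c∈C c'∈C x⊕c≐x'⊕c' j = begin
      x j                        ≡⟨ add-subtract (x j) (+ c j) ⟩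
      (x j +ℤ + c j) -ℤ + c j     ≡⟨ cong₂ (λ a b → a -ℤ + b) (x⊕c≐x'⊕c' j) (c≐c' j) ⟩
      (x' j +ℤ + c' j) -ℤ + c' j  ≡⟨ add-subtract (x' j) (+ c' j) ⟨
      x' j                       ∎
    where
    open ≡-Reasoning
    add-subtract : ∀ a b → a ≡ (a +ℤ b) -ℤ b
    add-subtract = solve-∀
    same-value : u *ℤ + k +ℤ + (c ·ℕ w) ≡ u' *ℤ + k +ℤ + (c' ·ℕ w)
    same-value = begin
      u *ℤ + k +ℤ + (c ·ℕ w)     ≡⟨ cong (_+ℤ + (c ·ℕ w)) ⟨x,w⟩≡uk ⟨
      x ·ℤ w +ℤ + (c ·ℕ w)       ≡⟨ ·ℤ-⊕ w x c ⟨
      (x ⊕ c) ·ℤ w               ≡⟨ ·ℤ-cong w x⊕c≐x'⊕c' ⟩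
      (x' ⊕ c') ·ℤ w             ≡⟨ ·ℤ-⊕ w x' c' ⟩
      x' ·ℤ w +ℤ + (c' ·ℕ w)     ≡⟨ cong (_+ℤ + (c' ·ℕ w)) ⟨x',w⟩≡u'k ⟩
      u' *ℤ + k +ℤ + (c' ·ℕ w)   ∎
    c≐c' : ∀ j → c j ≡ c' j
    c≐c' = separate c c' c∈C c'∈C
      (%-congruent k (c ·ℕ w) (c' ·ℕ w) (u' -ℤ u) (shift-multiples _ _ u u' (+ k) same-value))

kernel-tiling : {r : ℕ} (k : ℕ) .{{_ : NonZero k}} (w : Fin r → ℕ) (C : (Fin r → ℕ) → Set) →
                CompleteResidueSystem k w C → IsTilingBy r C (Kernel k w)
kernel-tiling k w C crs = kernel-covers k w C crs , kernel-translates-disjoint k w C crs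

-- Part 2.  Exponent vectors over a list of primes

expand : (ps : List ℕ) → (Fin (length ps) → ℕ) → ℕ
expand ps c = prodFin (length ps) (λ j → lookup ps j ^ c j)

expand-nonZero : ∀ {ps} → All Prime ps → (c : Fin (length ps) → ℕ) → NonZero (expand ps c)
expand-nonZero []                c = _
expand-nonZero {p ∷ ps} (pp ∷ pps) c =
  m*n≢0 (p ^ head c) (expand ps (tail c))
    {{m^n≢0 p (head c) {{prime⇒nonZero pp}}}} {{expand-nonZero pps (tail c)}}

expand-increment : ∀ ps (c : Fin (length ps) → ℕ) j →
  expand ps (updateAt c j suc) ≡ lookup ps j * expand ps c
expand-increment (p ∷ ps) c zero    = *-assoc p (p ^ head c) (expand ps (tail c))
expand-increment (p ∷ ps) c (suc j) = begin
    p ^ head c * expand ps (updateAt (tail c) j suc)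
  ≡⟨ cong (p ^ head c *_) (expand-increment ps (tail c) j) ⟩
    p ^ head c * (lookup ps j * expand ps (tail c))
  ≡⟨ x∙yz≈y∙xz (p ^ head c) (lookup ps j) (expand ps (tail c)) ⟩
    lookup ps j * (p ^ head c * expand ps (tail c))
  ∎
  where open ≡-Reasoning

prime∤power : ∀ {p q} → Prime p → Prime q → p ≢ q → ∀ e → ¬ (p ∣ q ^ e)
prime∤power pp pq p≢q zero p∣1 with ∣1⇒≡1 p∣1
... | refl = ¬prime[1] pp
prime∤power {q = q} pp pq p≢q (suc e) p∣q^1+e with euclidsLemma q (q ^ e) pp p∣q^1+e
... | inj₂ p∣q^e = prime∤power pp pq p≢q e p∣q^e
... | inj₁ p∣q with prime⇒irreducible pq p∣q
...   | inj₁ refl = ¬prime[1] pp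
...   | inj₂ p≡q  = p≢q p≡q

prime∤expand : ∀ {p} → Prime p → ∀ {ps} → All Prime ps → All (p ≢_) ps →
  (c : Fin (length ps) → ℕ) → ¬ (p ∣ expand ps c)
prime∤expand pp [] [] c p∣1 with ∣1⇒≡1 p∣1
... | refl = ¬prime[1] pp
prime∤expand pp {q ∷ ps} (pq ∷ pps) (p≢q ∷ p∉ps) c p∣expand
  with euclidsLemma (q ^ head c) (expand ps (tail c)) pp p∣expand
... | inj₁ p∣q^c = prime∤power pp pq p≢q (head c) p∣q^c
... | inj₂ p∣rest = prime∤expand pp pps p∉ps (tail c) p∣rest

valuation-unique : ∀ {p} → Prime p → ∀ e e' A A' → ¬ (p ∣ A) → ¬ (p ∣ A') →
  p ^ e * A ≡ p ^ e' * A' → e ≡ e' × A ≡ A'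
valuation-unique {p} pp zero zero A A' _ _ eq =
  refl , trans (sym (*-identityˡ A)) (trans eq (*-identityˡ A'))
valuation-unique {p} pp zero (suc e') A A' p∤A _ eq =
  ⊥-elim (p∤A (divides-higher-power e' A A' (trans (sym (*-identityˡ A)) eq)))
  where
  divides-higher-power : ∀ e A A' → A ≡ p ^ suc e * A' → p ∣ A
  divides-higher-power e A A' eq = divides (p ^ e * A') (trans eq (trans (*-assoc p _ _) (*-comm p _)))
valuation-unique {p} pp (suc e) zero A A' p∤A p∤A' eq with valuation-unique pp zero (suc e) A' A p∤A' p∤A (sym eq)
... | () , _
valuation-unique {p} pp (suc e) (suc e') A A' p∤A p∤A' eq
  with valuation-unique pp e e' A A' p∤A p∤A'
         (*-cancelˡ-≡ _ _ p {{prime⇒nonZero pp}}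
           (trans (sym (*-assoc p (p ^ e) A)) (trans eq (*-assoc p (p ^ e') A'))))
... | refl , A≡A' = refl , A≡A'

expand-injective : ∀ {ps} → All Prime ps → Unique ps → (c c' : Fin (length ps) → ℕ) →
  expand ps c ≡ expand ps c' → ∀ j → c j ≡ c' j
expand-injective {p ∷ ps} (pp ∷ pps) (p∉ps ∷ distinct) c c' eq j
  with valuation-unique pp (head c) (head c') _ _
         (prime∤expand pp pps p∉ps (tail c)) (prime∤expand pp pps p∉ps (tail c')) eq
expand-injective (pp ∷ pps) (p∉ps ∷ distinct) c c' eq zero    | head≡ , _ = head≡
expand-injective (pp ∷ pps) (p∉ps ∷ distinct) c c' eq (suc j) | _ , rest≡ =
  expand-injective pps distinct (tail c) (tail c') rest≡ j

primesUpTo-prime : ∀ k → All Prime (primesUpTo k)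
primesUpTo-prime k = all-filter prime? (upTo (suc k))

primesUpTo-unique : ∀ k → Unique (primesUpTo k)
primesUpTo-unique k = Unique.filter⁺ prime? (Unique.upTo⁺ (suc k))

product-expand : ∀ k (as : List ℕ) → All Prime as → product as ≤ k →
  Σ (Fin (π k) → ℕ) λ c → expand (primesUpTo k) c ≡ product as
product-expand k [] [] _ = (λ _ → 0) , expand-zero (primesUpTo k)
  where
  expand-zero : ∀ ps → expand ps (λ _ → 0) ≡ 1
  expand-zero []       = refl
  expand-zero (p ∷ ps) = trans (+-identityʳ _) (expand-zero ps)
product-expand k (p ∷ as) (pp ∷ pas) p*as≤k = updateAt c j suc , (begin
    expand (primesUpTo k) (updateAt c j suc) ≡⟨ expand-increment (primesUpTo k) c j ⟩
    lookup (primesUpTo k) j * expand (primesUpTo k) c ≡⟨ cong₂ _*_ (sym (lookup-index p∈primes)) c-expands ⟩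
    p * product as ∎)
  where
  open ≡-Reasoning
  instance
    p≢0 : NonZero p
    p≢0 = prime⇒nonZero pp
    as≢0 : NonZero (product as)
    as≢0 = productOfPrimes≢0 pas
  rest = product-expand k as pas (≤-trans (m≤n*m (product as) p) p*as≤k)
  c = proj₁ rest
  c-expands = proj₂ rest
  p∈primes = ∈-filter⁺ prime? (∈-upTo⁺ (s≤s (≤-trans (m≤m*n p (product as)) p*as≤k))) pp
  j = index p∈primes

expand-surjective : ∀ k m .{{_ : NonZero m}} → m ≤ k →
  Σ (Fin (π k) → ℕ) λ c → expand (primesUpTo k) c ≡ m
expand-surjective k m m≤k with factorise m
... | record { factors = as ; isFactorisation = ∏as≡m ; factorsPrime = pas }
  with product-expand k as pas (subst (_≤ k) ∏as≡m m≤k)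
...   | c , c-expands = c , trans c-expands (sym ∏as≡m)

-- Part 3.  A function on {1,…,k} (k = suc n) with values in ℤ_k, extended to ℕ

module Extension (n : ℕ) (f : Fin (suc n) → Fin (suc n)) where

  k : ℕ
  k = suc n

  -- G m = f(m) for 1 ≤ m ≤ k, read as a residue in {0,…,k-1}; G m = 0 otherwise.
  G : ℕ → ℕ
  G zero = 0
  G (suc m) with m <? k
  ... | yes m<k = toℕ (f (fromℕ< m<k))
  ... | no  _   = 0

  G-val : ∀ m (m<k : m < k) → G (suc m) ≡ toℕ (f (fromℕ< m<k))
  G-val m m<k with m <? k
  ... | yes _   = refl
  ... | no  m≮k = ⊥-elim (m≮k m<k)

  G-index : ∀ (a : Fin k) → G (suc (toℕ a)) ≡ toℕ (f a)
  G-index a = trans (G-val (toℕ a) (toℕ<n a)) (cong (λ b → toℕ (f b)) (fromℕ<-toℕ a (toℕ<n a)))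

  G<k : ∀ m → G m < k
  G<k zero = s≤s z≤n
  G<k (suc m) with m <? k
  ... | yes m<k = toℕ<n (f (fromℕ< m<k))
  ... | no  _   = s≤s z≤n

  %-cong-+ : ∀ a b a' b' → a % k ≡ a' % k → b % k ≡ b' % k → (a + b) % k ≡ (a' + b') % k
  %-cong-+ a b a' b' a≡a' b≡b' =
    trans (%-distribˡ-+ a b k) (trans (cong₂ (λ u v → (u + v) % k) a≡a' b≡b') (sym (%-distribˡ-+ a' b' k)))

  module Logarithmic (logf : IsLogarithmic n f) where

    G-mul : ∀ a b .{{_ : NonZero a}} .{{_ : NonZero b}} → a * b ≤ k → G (a * b) ≡ (G a + G b) % k
    G-mul (suc a) (suc b) ab≤k =
      trans (G-val _ ab≤k)
        (trans (logf (fromℕ< a<k) (fromℕ< b<k) (fromℕ< ab≤k) indices-multiply)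
          (cong₂ (λ u v → (u + v) % k) (sym (G-val a a<k)) (sym (G-val b b<k))))
      where
      a<k : a < k
      a<k = ≤-trans (m≤m*n (suc a) (suc b)) ab≤k
      b<k : b < k
      b<k = ≤-trans (m≤n*m (suc b) (suc a)) ab≤k
      indices-multiply : (toℕ (fromℕ< a<k) + 1) * (toℕ (fromℕ< b<k) + 1) ≡ toℕ (fromℕ< ab≤k) + 1
      indices-multiply rewrite toℕ-fromℕ< a<k | toℕ-fromℕ< b<k | toℕ-fromℕ< ab≤k =
        trans (cong₂ _*_ (+-comm a 1) (+-comm b 1)) (+-comm 1 (b + a * suc b))

    -- G(1) = 0, since G(1) = 2·G(1) in ℤ_k and 0 ≤ G(1) < k.
    G-one : G 1 ≡ 0
    G-one = fixed-by-doubling (G 1) (G<k 1) (G-mul 1 1 (s≤s z≤n))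
      where
      fixed-by-doubling : ∀ x → x < k → x ≡ (x + x) % k → x ≡ 0
      fixed-by-doubling x x<k x≡2x with (x + x) / k
                                    | +-cancelˡ-≡ x x _ (trans (m≡m%n+[m/n]*n (x + x) k)
                                                               (cong (_+ ((x + x) / k) * k) (sym x≡2x)))
      ... | zero  | x≡0   = x≡0
      ... | suc m | x≡k+m = ⊥-elim (<⇒≱ x<k (subst (k ≤_) (sym x≡k+m) (m≤m+n k (m * k))))

    G-power : ∀ p e .{{_ : NonZero p}} → p ^ e ≤ k → G (p ^ e) % k ≡ (e * G p) % k
    G-power p zero    _       = cong (_% k) G-one
    G-power p (suc e) p^1+e≤k = begin
        G (p * p ^ e) % k         ≡⟨ cong (_% k) (G-mul p (p ^ e) p^1+e≤k) ⟩
        (G p + G (p ^ e)) % k % k ≡⟨ m%n%n≡m%n (G p + G (p ^ e)) k ⟩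
        (G p + G (p ^ e)) % k     ≡⟨ %-cong-+ (G p) (G (p ^ e)) (G p) (e * G p) refl
                                       (G-power p e (≤-trans (m≤n*m (p ^ e) p) p^1+e≤k)) ⟩
        (G p + e * G p) % k       ∎
      where
      open ≡-Reasoning
      instance
        p^e≢0 : NonZero (p ^ e)
        p^e≢0 = m^n≢0 p e

    G-expand : ∀ {ps} → All Prime ps → (c : Fin (length ps) → ℕ) → expand ps c ≤ k →
      G (expand ps c) % k ≡ (c ·ℕ (λ j → G (lookup ps j))) % k
    G-expand [] c _ = cong (_% k) G-one
    G-expand {p ∷ ps} (pp ∷ pps) c expand≤k = begin
        G (p ^ head c * Q) % k ≡⟨ cong (_% k) (G-mul (p ^ head c) Q expand≤k) ⟩
        (G (p ^ head c) + G Q) % k % k ≡⟨ m%n%n≡m%n (G (p ^ head c) + G Q) k ⟩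
        (G (p ^ head c) + G Q) % k ≡⟨ %-cong-+ (G (p ^ head c)) (G Q) (head c * G p) (tail c ·ℕ (λ j → G (lookup ps j)))
                                        (G-power p (head c) (≤-trans (m≤m*n (p ^ head c) Q) expand≤k))
                                        (G-expand pps (tail c) (≤-trans (m≤n*m Q (p ^ head c)) expand≤k)) ⟩
        (head c * G p + tail c ·ℕ (λ j → G (lookup ps j))) % k ∎
      where
      open ≡-Reasoning
      Q = expand ps (tail c)
      instance
        p≢0 : NonZero p
        p≢0 = prime⇒nonZero pp
        p^c≢0 : NonZero (p ^ head c)
        p^c≢0 = m^n≢0 p (head c)
        Q≢0 : NonZero Q
        Q≢0 = expand-nonZero pps (tail c)

-- Part 4.  The residue system of a logarithm

primeWeight : (n : ℕ) → (Fin (suc n) → Fin (suc n)) → Fin (π (suc n)) → ℕ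
primeWeight n f j = Extension.G n f (lookup (primesUpTo (suc n)) j)

-- For a logarithm, 𝒞_k is a complete residue system modulo k for the prime
-- weights: c ↦ ⟨c,w⟩ mod k is G ∘ expand, a composite of two bijections.
logarithm-residue-system : ∀ n (f : Fin (suc n) → Fin (suc n)) → IsLogarithm n f →
  CompleteResidueSystem (suc n) (primeWeight n f) (InC (suc n))
logarithm-residue-system n f (logf , f-injective , f-surjective) = record
  { hit = hit ; separate = separate }
  where
  open Extension n f
  open Logarithmic logf

  ps = primesUpTo k

  residue-is-G : ∀ c → InC k c → (c ·ℕ primeWeight n f) % k ≡ G (expand ps c)
  residue-is-G c c∈C = trans (sym (G-expand (primesUpTo-prime k) c c∈C)) (m<n⇒m%n≡m (G<k (expand ps c)))

  hit : ∀ t → t < k → Σ (Fin (π k) → ℕ) λ c → InC k c × (c ·ℕ primeWeight n f) % k ≡ t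
  hit t t<k = c , c∈C , (begin
      (c ·ℕ primeWeight n f) % k ≡⟨ residue-is-G c c∈C ⟩
      G (expand ps c)            ≡⟨ cong G c-expands ⟩
      G (suc (toℕ a))            ≡⟨ G-index a ⟩
      toℕ (f a)                  ≡⟨ cong toℕ (proj₂ (f-surjective (fromℕ< t<k)) refl) ⟩
      toℕ (fromℕ< t<k)           ≡⟨ toℕ-fromℕ< t<k ⟩
      t                          ∎)
    where
    open ≡-Reasoning
    a = proj₁ (f-surjective (fromℕ< t<k))
    expansion = expand-surjective k (suc (toℕ a)) (toℕ<n a)
    c = proj₁ expansion
    c-expands = proj₂ expansion
    c∈C : InC k c
    c∈C = subst (_≤ k) (sym c-expands) (toℕ<n a)

  G-injective : ∀ m m' .{{_ : NonZero m}} .{{_ : NonZero m'}} → m ≤ k → m' ≤ k → G m ≡ G m' → m ≡ m'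
  G-injective (suc a) (suc a') a<k a'<k Ga≡Ga' = cong suc (begin
      a                   ≡⟨ toℕ-fromℕ< a<k ⟨
      toℕ (fromℕ< a<k)    ≡⟨ cong toℕ (f-injective (toℕ-injective f-values-agree)) ⟩
      toℕ (fromℕ< a'<k)   ≡⟨ toℕ-fromℕ< a'<k ⟩
      a'                  ∎)
    where
    open ≡-Reasoning
    f-values-agree : toℕ (f (fromℕ< a<k)) ≡ toℕ (f (fromℕ< a'<k))
    f-values-agree = trans (sym (G-val a a<k)) (trans Ga≡Ga' (G-val a' a'<k))

  separate : ∀ c c' → InC k c → InC k c' →
    (c ·ℕ primeWeight n f) % k ≡ (c' ·ℕ primeWeight n f) % k → ∀ j → c j ≡ c' j
  separate c c' c∈C c'∈C same-residue =
    expand-injective (primesUpTo-prime k) (primesUpTo-unique k) c c'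
      (G-injective (expand ps c) (expand ps c')
        {{expand-nonZero (primesUpTo-prime k) c}} {{expand-nonZero (primesUpTo-prime k) c'}}
        c∈C c'∈C
        (trans (sym (residue-is-G c c∈C)) (trans same-residue (residue-is-G c' c'∈C))))

theorem5p3 : (n : ℕ) →
    Σ (Fin (suc n) → Fin (suc n)) (IsLogarithm n) →
    ∃ λ (L : (Fin (π (suc n)) → ℤ) → Set) → IsTiling (suc n) L
theorem5p3 n (f , isLogarithm) =
  Kernel (suc n) (primeWeight n f) ,
  kernel-tiling (suc n) (primeWeight n f) (InC (suc n)) (logarithm-residue-system n f isLogarithm)
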